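{- $\vDash_{\mathsf{PI}}\Box\forall x\in\mathbb{N}\,\Diamond\exists y\in\mathbb{N}\; Sxy$.
   Context: PI model: $\mathcal{M}=\langle W,R,D,I\rangle$ with $W$ countably infinite, $R$ a directed partial order, each $D(w)$ non-empty finite, $n$-ary second-order quantifiers at $w$ range over all subsets of $D(w)^n$, $D(w)\subsetneq D(s)$ whenever $R(w,s)$, $w\ne s$, and an injection $\mathbf{a}:\omega\to\bigcup_wD(w)$ with $\#X=\mathbf{a}_{|X|}$ at every world for all $X\subseteq D(s)$, $s\in W$. Kripke semantics: actualist first-order quantifiers over $D(w)$, free variables may denote any object of the model, rigid set variables, $\Box$ over $R$-successors. $\vDash_{\mathsf{PI}}\varphi$: $\varphi$ true at every world of every PI model under every assignment. Definitions: $0:=\#\varnothing$; $Sxy:\equiv\Diamond\exists G\exists u[Gu\wedge y=\#G\wedge x=\#(G\setminus\{u\})]$; $S^+(a,b):\equiv\forall X[(\forall x,y(Xx\wedge Sxy\rightarrow Xy)\wedge\forall x(Sax\rightarrow Xx))\rightarrow Xb]$; $S^{+=}(a,b):\equiv S^+(a,b)\vee a=b$; $\mathbb{N}x:\equiv S^{+=}(0,x)\wedge\exists y(y=0)$; $\forall x\in\mathbb{N}\,\varphi$ abbreviates $\forall x(\mathbb{N}x\rightarrow\varphi)$, $\exists x\in\mathbb{N}\,\varphi$ abbreviates $\exists x(\mathbb{N}x\wedge\varphi)$. -}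

module Defs where

open import Level using (Level; Lift; lift) renaming (suc to lsuc; zero to lzero)
open import Data.Nat using (ℕ)
open import Data.List using (List; length)
open import Data.List.Membership.Propositional using (_∈_)
open import Data.List.Relation.Unary.Unique.Propositional using (Unique)
open import Data.Product using (Σ; ∃; ∃-syntax; _×_; _,_)
open import Data.Sum using (_⊎_)
open import Data.Empty using (⊥)
open import Relation.Nullary using (¬_)
open import Relation.Binary.PropositionalEquality using (_≡_; _≢_)
open import Function.Bundles using (_↔_; _⇔_)

HasCard : {O : Set} → (O → Set) → ℕ → Set
HasCard {O} X n =
  Σ (List O) λ xs → (length xs ≡ n) × Unique xs × (∀ o → X o ⇔ o ∈ xs)

-- PI models.  O is the set of all objects of the model (= ⋃_w D(w)),
-- D w is the (finite, non-empty) domain of world w, given as a predicate.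

record PIModel : Set₁ where
  field
    W           : Set
    W-countable : W ↔ ℕ
    R           : W → W → Set
    R-refl      : ∀ w → R w w
    R-trans     : ∀ {u v w} → R u v → R v w → R u w
    R-antisym   : ∀ {u v} → R u v → R v u → u ≡ v
    R-directed  : ∀ u v → ∃[ t ] (R u t × R v t)
    O           : Set
    D           : W → O → Set
    D-finite    : ∀ w → ∃[ xs ] (∀ o → D w o ⇔ o ∈ xs)
    D-nonempty  : ∀ w → ∃[ o ] D w o
    D-strict    : ∀ {w s} → R w s → w ≢ s →
                  (∀ o → D w o → D s o) × (∃[ o ] (D s o × ¬ D w o))
    O-union     : ∀ o → ∃[ w ] D w o
    a           : ℕ → O
    a-injective : ∀ {m n} → a m ≡ a n → m ≡ n

-- A formula is a predicate on worlds;
-- object variables are Agda variables ranging over all of O (free variables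
-- may denote any object); set variables are rigid predicates on O.

module Sem (M : PIModel) where
  open PIModel M public

  Form : Set₂
  Form = W → Set₁

  Pred : Set₁
  Pred = O → Set

  infixr 4 _⇒_
  infixr 5 _∨_
  infixr 6 _∧_

  _∧_ : Form → Form → Form
  (φ ∧ ψ) w = φ w × ψ w

  _∨_ : Form → Form → Form
  (φ ∨ ψ) w = φ w ⊎ ψ w

  _⇒_ : Form → Form → Form
  (φ ⇒ ψ) w = φ w → ψ w

  □ : Form → Form
  □ φ w = ∀ s → R w s → φ s

  ◇ : Form → Form
  ◇ φ w = Σ W λ s → R w s × φ s

  ∀₁ : (O → Form) → Form
  ∀₁ φ w = ∀ o → D w o → φ o w

  ∃₁ : (O → Form) → Form
  ∃₁ φ w = Σ O λ o → D w o × φ o w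

  ∀₂ : (Pred → Form) → Form
  ∀₂ φ w = ∀ (X : Pred) → (∀ o → X o → D w o) → φ X w

  ∃₂ : (Pred → Form) → Form
  ∃₂ φ w = Σ Pred λ X → (∀ o → X o → D w o) × φ X w

  _≐_ : O → O → Form
  (x ≐ y) w = Lift _ (x ≡ y)

  app : Pred → O → Form
  app X x w = Lift _ (X x)

  -- x = #X, where #X denotes a_{|X|}
  _≐#_ : O → Pred → Form
  (x ≐# X) w = Lift _ (∃[ n ] (HasCard X n × x ≡ a n))

  _∖｛_｝ : Pred → O → Pred
  (G ∖｛ u ｝) o = G o × o ≢ u

  -- 0 := #∅, which denotes a_{|∅|} = a_0
  𝟘 : O
  𝟘 = a 0

  S : O → O → Form
  S x y = ◇ (∃₂ λ G → ∃₁ λ u → app G u ∧ (y ≐# G) ∧ (x ≐# (G ∖｛ u ｝)))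

  S⁺ : O → O → Form
  S⁺ p q = ∀₂ λ X →
    ((∀₁ λ x → ∀₁ λ y → (app X x ∧ S x y) ⇒ app X y)
     ∧ (∀₁ λ x → S p x ⇒ app X x))
    ⇒ app X q

  S⁺⁼ : O → O → Form
  S⁺⁼ p q = S⁺ p q ∨ (p ≐ q)

  Nat : O → Form
  Nat x = S⁺⁼ 𝟘 x ∧ ∃₁ (λ y → y ≐ 𝟘)

  ∀ℕ : (O → Form) → Form
  ∀ℕ φ = ∀₁ λ x → Nat x ⇒ φ x

  ∃ℕ : (O → Form) → Form
  ∃ℕ φ = ∃₁ λ x → Nat x ∧ φ x

-- In a PI model a world containing the k + 1 distinct objects a₀, …, a_k witnesses
-- S a_j a_{j+1} for every j < k: take G := {a₀, …, a_j} and u := a_j.  Every number x at a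
-- world s is some a_n, since S only ever reaches objects of the form #G.  Directedness
-- gives a successor t of s containing a₀, …, a_{n+1}; there a_{n+1} is a number (the
-- chain a₀ S a₁ S ⋯ S a_{n+1} lies in t) and S a_n a_{n+1} holds.
module Submission where

open import Defs
open import Level using (lift; lower)
open import Data.Nat using (ℕ; zero; suc; z<s)
open import Data.Nat.Properties using (eq?; <⇒≢)
open import Data.List using (List; []; _∷_; length; applyDownFrom)
open import Data.List.Properties using (length-applyDownFrom)
open import Data.List.Membership.Propositional using (_∈_)
open import Data.List.Membership.Propositional.Properties using (∈-applyDownFrom⁺)
open import Data.List.Relation.Unary.Any using (here; there)
open import Data.List.Relation.Unary.All as All using (All; []; _∷_)
open import Data.List.Relation.Unary.AllPairs using (_∷_)
open import Data.List.Relation.Unary.Unique.Propositional using (Unique)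
open import Data.List.Relation.Unary.Unique.Propositional.Properties using (applyDownFrom⁺₁)
open import Data.Product using (∃-syntax; _×_; _,_; proj₁; proj₂)
open import Data.Sum using (inj₁; inj₂)
open import Data.Empty using (⊥-elim)
open import Relation.Nullary using (yes; no)
open import Relation.Binary.PropositionalEquality using (_≡_; _≢_; refl; sym; subst)
open import Function.Base using (_∘_)
open import Function.Bundles using (_⇔_; mk⇔)
open import Function.Construct.Identity using (⇔-id)
open import Function.Construct.Composition using (_⇔-∘_)
open import Function.Construct.Symmetry using (⇔-sym)
open import Function.Properties.Inverse using (↔⇒↣)

HasCard-∈ : {O : Set} (xs : List O) → Unique xs → HasCard (_∈ xs) (length xs)
HasCard-∈ xs xs! = xs , refl , xs! , λ _ → ⇔-id _

HasCard-cong : {O : Set} {X Y : O → Set} {n : ℕ} →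
               (∀ o → X o ⇔ Y o) → HasCard X n → HasCard Y n
HasCard-cong X⇔Y (xs , len , xs! , X⇔∈) = xs , len , xs! , λ o → X⇔∈ o ⇔-∘ ⇔-sym (X⇔Y o)

∈-∷-∖-head⇔∈ : {O : Set} {x o : O} {xs : List O} →
               Unique (x ∷ xs) → (o ∈ x ∷ xs × o ≢ x) ⇔ o ∈ xs
∈-∷-∖-head⇔∈ {x = x} {xs = xs} (x∉xs ∷ _) = mk⇔ to from
  where
  to : ∀ {o} → o ∈ x ∷ xs × o ≢ x → o ∈ xs
  to (here o≡x , o≢x) = ⊥-elim (o≢x o≡x)
  to (there o∈xs , _) = o∈xs

  from : ∀ {o} → o ∈ xs → o ∈ x ∷ xs × o ≢ x
  from o∈xs = there o∈xs , λ o≡x → All.lookup x∉xs o∈xs (sym o≡x)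

module PI (M : PIModel) where
  open Sem M

  -- D-strict only speaks about distinct worlds; countability makes equality of worlds decidable.
  D-mono : ∀ {u v o} → R u v → D u o → D v o
  D-mono {u} {v} {o} u≤v o∈Du with eq? (↔⇒↣ W-countable) u v
  ... | yes refl = o∈Du
  ... | no u≢v = proj₁ (D-strict u≤v u≢v) o o∈Du

  ∃-successor-⊇ : ∀ s (xs : List O) → ∃[ t ] (R s t × All (D t) xs)
  ∃-successor-⊇ s [] = s , R-refl s , []
  ∃-successor-⊇ s (x ∷ xs) with ∃-successor-⊇ s xs | O-union x
  ... | t , s≤t , xs⊆Dt | v , x∈Dv with R-directed t v
  ... | u , t≤u , v≤u = u , R-trans s≤t t≤u , D-mono v≤u x∈Dv ∷ All.map (D-mono t≤u) xs⊆Dt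

  S-distinct : ∀ {t x xs} → Unique (x ∷ xs) → All (D t) (x ∷ xs) →
               S (a (length xs)) (a (suc (length xs))) t
  S-distinct {t} {x} {xs} x∷xs!@(_ ∷ xs!) x∷xs⊆Dt =
    t , R-refl t , (_∈ x ∷ xs) , (λ _ → All.lookup x∷xs⊆Dt) , x , All.head x∷xs⊆Dt , lift (here refl) ,
      lift (_ , HasCard-∈ (x ∷ xs) x∷xs! , refl) ,
      lift (_ , HasCard-cong (λ _ → ⇔-sym (∈-∷-∖-head⇔∈ x∷xs!)) (HasCard-∈ xs xs!) , refl)

  initial : ℕ → List O
  initial = applyDownFrom a

  initial-unique : ∀ k → Unique (initial k)
  initial-unique k = applyDownFrom⁺₁ a k (λ j<i _ → <⇒≢ j<i ∘ sym ∘ a-injective)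

  S-initial : ∀ {t} k → All (D t) (initial (suc k)) → S (a k) (a (suc k)) t
  S-initial {t} k initial⊆Dt =
    subst (λ n → S (a n) (a (suc n)) t) (length-applyDownFrom a k)
          (S-distinct (initial-unique (suc k)) initial⊆Dt)

  Numeral : O → Set
  Numeral o = ∃[ n ] (o ≡ a n)

  S-numeral : ∀ {p q t} → S p q t → Numeral q
  S-numeral (_ , _ , _ , _ , _ , _ , _ , lift (n , _ , q≡aₙ) , _) = n , q≡aₙ

  S⁺-numeral : ∀ {p q s} → S⁺ p q s → Numeral q
  S⁺-numeral {p} {s = s} p<q = proj₂ (lower (p<q X (λ _ → proj₁) (step , base)))
    where
    X : Pred
    X o = D s o × Numeral o

    step : ∀ x → D s x → ∀ y → D s y → app X x s × S x y s → app X y s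
    step _ _ _ y∈Ds (_ , Sxy) = lift (y∈Ds , S-numeral Sxy)

    base : ∀ y → D s y → S p y s → app X y s
    base _ y∈Ds Spy = lift (y∈Ds , S-numeral Spy)

  ℕ-numeral : ∀ {x s} → Nat x s → Numeral x
  ℕ-numeral (inj₁ 0<x , _)         = S⁺-numeral 0<x
  ℕ-numeral (inj₂ (lift refl) , _) = 0 , refl

  S⁺-𝟘-initial : ∀ {t} n → All (D t) (initial (suc (suc n))) → S⁺ 𝟘 (a (suc n)) t
  S⁺-𝟘-initial {t} n initial⊆Dt X _ (step , base) = lift (chain n initial⊆Dt)
    where
    chain : ∀ m → All (D t) (initial (suc (suc m))) → X (a (suc m))
    chain zero    (a₁∈Dt ∷ ⊆Dt) = lower (base (a 1) a₁∈Dt (S-initial 0 ⊆Dt))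
    chain (suc m) (aₘ₊₂∈Dt ∷ ⊆Dt@(aₘ₊₁∈Dt ∷ _)) =
      lower (step (a (suc m)) aₘ₊₁∈Dt (a (suc (suc m))) aₘ₊₂∈Dt
                  (lift (chain m ⊆Dt) , S-initial (suc m) ⊆Dt))

  ◇-ℕ-successor : ∀ s n → ◇ (∃ℕ λ y → S (a n) y) s
  ◇-ℕ-successor s n with ∃-successor-⊇ s (initial (suc (suc n)))
  ... | t , s≤t , ⊆Dt@(aₙ₊₁∈Dt ∷ ⊆Dt′) =
    t , s≤t , a (suc n) , aₙ₊₁∈Dt ,
      (inj₁ (S⁺-𝟘-initial n ⊆Dt) , 𝟘 , All.lookup ⊆Dt (∈-applyDownFrom⁺ a z<s) , lift refl) ,
      S-initial n ⊆Dt′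

open PI using (ℕ-numeral; ◇-ℕ-successor)

lemma8 : (M : PIModel) → let open Sem M in
           ∀ (w : W) → □ (∀ℕ λ x → ◇ (∃ℕ λ y → S x y)) w
lemma8 M w s _ x _ x∈ℕ with ℕ-numeral M x∈ℕ
... | n , refl = ◇-ℕ-successor M s n
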